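{- Let $k\ge 2$ be an integer. Let $\tau_1,\tau_2,\pi_1,\pi_2$ be permutations (possibly empty) with $\tau_1\equiv_k\tau_2$ and $\pi_1\equiv_k\pi_2$. Then $\tau_1\oplus(1\ominus\pi_1)\equiv_k\tau_2\oplus(1\ominus\pi_2)$. In other words, the logical type of order $k$ of $\tau\oplus(1\ominus\pi)$ depends only on the logical types of order $k$ of $\tau$ and of $\pi$.
   Context: Permutations are viewed as finite structures $(A,<_P,<_V)$ with two linear orders (comparing positions and values of the points of the permutation diagram). The quantifier depth of a first-order formula is the maximal number of nested quantifiers (atomic formulas have depth 0; negation preserves depth; $\wedge,\vee$ take the maximum; $\exists x\,\psi$ and $\forall x\,\psi$ have depth one more than $\psi$). Two permutations are $k$-equivalent, written $\sigma\equiv_k\tau$, if they satisfy exactly the same first-order sentences (in the language $\{<_P,<_V\}$) of quantifier depth at most $k$; the equivalence classes are the logical types of order $k$. The direct sum $\tau\oplus\pi$ is obtained by concatenating the one-line notations of $\tau$ and $\pi$ and increasing all values of $\pi$ by $|\tau|$; the skew sum $\tau\ominus\pi$ is obtained by concatenation, increasing all values of $\tau$ by $|\pi|$. Here $1$ denotes the permutation of size $1$. -}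

module Defs where

open import Data.Nat using (ℕ; zero; suc; _+_; _<_; _≤_; _⊔_)
open import Data.Fin using (Fin; toℕ) renaming (zero to fz; suc to fs)
open import Data.List using (List; []; _∷_; _++_; map; length; upTo; lookup)
open import Data.List.Relation.Binary.Permutation.Propositional using (_↭_)
open import Data.Product using (Σ; _×_)
open import Data.Sum using (_⊎_)
open import Relation.Binary.PropositionalEquality using (_≡_)
open import Relation.Nullary using (¬_)
open import Function.Bundles using (_⇔_)

-- A permutation of size n is given by its one-line notation, a list of the
-- values 0,…,n-1 (0-based) in position order.
IsPerm : List ℕ → Set
IsPerm l = l ↭ upTo (length l)

_⊕_ : List ℕ → List ℕ → List ℕ
τ ⊕ π = τ ++ map (λ v → v + length τ) π

_⊖_ : List ℕ → List ℕ → List ℕ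
τ ⊖ π = map (λ v → v + length π) τ ++ π

one : List ℕ
one = 0 ∷ []

data Formula (n : ℕ) : Set where
  _<P_ : Fin n → Fin n → Formula n
  _<V_ : Fin n → Fin n → Formula n
  _≐_  : Fin n → Fin n → Formula n
  ¬'_  : Formula n → Formula n
  _∧'_ : Formula n → Formula n → Formula n
  _∨'_ : Formula n → Formula n → Formula n
  ∃'   : Formula (suc n) → Formula n
  ∀'   : Formula (suc n) → Formula n

depth : ∀ {n} → Formula n → ℕ
depth (x <P y) = 0
depth (x <V y) = 0
depth (x ≐ y) = 0
depth (¬' φ) = depth φ
depth (φ ∧' ψ) = depth φ ⊔ depth ψ
depth (φ ∨' ψ) = depth φ ⊔ depth ψ
depth (∃' φ) = suc (depth φ)
depth (∀' φ) = suc (depth φ)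

-- the domain of the structure of σ is the set of points (indexed by position)
Pt : List ℕ → Set
Pt σ = Fin (length σ)

extend : ∀ {n} {A : Set} → A → (Fin n → A) → Fin (suc n) → A
extend a ρ fz = a
extend a ρ (fs i) = ρ i

Sat : (σ : List ℕ) → ∀ {n} → Formula n → (Fin n → Pt σ) → Set
Sat σ (x <P y) ρ = toℕ (ρ x) < toℕ (ρ y)
Sat σ (x <V y) ρ = lookup σ (ρ x) < lookup σ (ρ y)
Sat σ (x ≐ y) ρ = ρ x ≡ ρ y
Sat σ (¬' φ) ρ = ¬ Sat σ φ ρ
Sat σ (φ ∧' ψ) ρ = Sat σ φ ρ × Sat σ ψ ρ
Sat σ (φ ∨' ψ) ρ = Sat σ φ ρ ⊎ Sat σ ψ ρ
Sat σ (∃' φ) ρ = Σ (Pt σ) (λ a → Sat σ φ (extend a ρ))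
Sat σ (∀' φ) ρ = (a : Pt σ) → Sat σ φ (extend a ρ)

Sentence : Set
Sentence = Formula 0

emptyEnv : ∀ {A : Set} → Fin 0 → A
emptyEnv ()

_≡[_]_ : List ℕ → ℕ → List ℕ → Set
σ ≡[ k ] τ = (φ : Sentence) → depth φ ≤ k → (Sat σ φ emptyEnv ⇔ Sat τ φ emptyEnv)

-- The k-round Ehrenfeucht–Fraïssé game is sound for k-equivalence, and for
-- finite structures with decidable relations also complete, because the
-- position of Duplicator is described by a characteristic formula of depth k.
-- Duplicator's strategies compose along ordered sums: a move in one block is
-- answered by the strategy for that block, while the other block keeps its
-- position with one round less.  Since τ ⊕ σ and σ ⊖ π are ordered sums of
-- τ (resp. π) and a shifted copy of σ, both ⊕ and ⊖ preserve k-equivalence of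
-- permutations, and the theorem follows by applying this twice.

module Submission where

open import Defs
open import Data.Empty using (⊥; ⊥-elim)
open import Data.Fin using (Fin; toℕ; cast; _↑ˡ_; _↑ʳ_; join; splitAt; _≟_)
  renaming (zero to fz; suc to fs)
open import Data.Fin.Properties
  using (toℕ-injective; toℕ<n; toℕ-cast; toℕ-↑ˡ; toℕ-↑ʳ; cast-involutive;
         cast-is-id; splitAt-join; join-splitAt)
open import Data.List using (List; []; _∷_; _++_; map; length; lookup; allFin)
open import Data.List.Properties using (length-map; length-++)
open import Data.List.Membership.Propositional using (_∈_)
open import Data.List.Membership.Propositional.Properties
  using (∈-allFin; ∈-lookup; ∈-map⁻; ∈-upTo⁻)
open import Data.List.Relation.Binary.Permutation.Propositional.Properties
  using (∈-resp-↭)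
open import Data.List.Relation.Unary.Any using (here; there)
open import Data.Maybe using (Maybe; just; nothing; maybe′)
import Data.Maybe as Maybe
open import Data.Nat using (ℕ; zero; suc; _+_; _<_; _≤_; _<?_; z≤n; s≤s)
open import Data.Nat.Properties
  using (<-≤-trans; <-asym; m≤m+n; m≤n+m; +-monoʳ-<; +-cancelˡ-<;
         +-monoˡ-<; +-cancelʳ-<; ⊔-lub; m⊔n≤o⇒m≤o; m⊔n≤o⇒n≤o)
open import Data.Product using (Σ; Σ-syntax; _×_; _,_; proj₁; proj₂; map₂; swap)
open import Data.Product.Function.NonDependent.Propositional using (_×-⇔_)
open import Data.Sum using (_⊎_; inj₁; inj₂; [_,_]′)
import Data.Sum as Sum
open import Data.Sum.Function.Propositional using (_⊎-⇔_)
open import Data.Sum.Properties using (inj₁-injective; inj₂-injective)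
open import Data.Unit using (⊤; tt)
open import Function using (_∘_; id; case_of_)
open import Function.Bundles using (_⇔_; mk⇔; Equivalence)
open import Function.Construct.Composition using (_⇔-∘_)
open import Function.Construct.Identity using (⇔-id)
open import Function.Construct.Symmetry using (⇔-sym)
open import Function.Related.TypeIsomorphisms using (¬-cong-⇔)
open import Relation.Binary.PropositionalEquality
  using (_≡_; refl; sym; trans; cong; subst; _≗_)
open import Relation.Nullary using (Dec; yes; no; ¬_)

open Equivalence using (to; from)

∃-cong-⇔ : {A : Set} {P Q : A → Set} → (∀ a → P a ⇔ Q a) → Σ A P ⇔ Σ A Q
∃-cong-⇔ P⇔Q = mk⇔ (map₂ (to (P⇔Q _))) (map₂ (from (P⇔Q _)))

∀-cong-⇔ : {A : Set} {P Q : A → Set} → (∀ a → P a ⇔ Q a) →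
           ((a : A) → P a) ⇔ ((a : A) → Q a)
∀-cong-⇔ P⇔Q = mk⇔ (λ p a → to (P⇔Q a) (p a)) (λ q a → from (P⇔Q a) (q a))

<-cong-⇔ : ∀ {a a′ b b′} → a ≡ a′ → b ≡ b′ → (a < b) ⇔ (a′ < b′)
<-cong-⇔ refl refl = ⇔-id _

toMaybe : ∀ {n} → Fin (suc n) → Maybe (Fin n)
toMaybe fz = nothing
toMaybe (fs i) = just i

maybe′-≗ : ∀ {I J X : Set} {ρ : I → X} {σ : J → X} (f : J → I) (x : X) →
           σ ≗ ρ ∘ f → maybe′ σ x ≗ maybe′ ρ x ∘ Maybe.map f
maybe′-≗ f x e nothing = refl
maybe′-≗ f x e (just j) = e j

pushˡ : ∀ {I J : Set} → Maybe (I ⊎ J) → Maybe I ⊎ J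
pushˡ nothing = inj₁ nothing
pushˡ (just (inj₁ i)) = inj₁ (just i)
pushˡ (just (inj₂ j)) = inj₂ j

pushʳ : ∀ {I J : Set} → Maybe (I ⊎ J) → I ⊎ Maybe J
pushʳ nothing = inj₂ nothing
pushʳ (just (inj₁ i)) = inj₁ i
pushʳ (just (inj₂ j)) = inj₂ (just j)

data Symbol : Set where
  position value equality : Symbol

symbols : List Symbol
symbols = position ∷ value ∷ equality ∷ []

∈-symbols : ∀ s → s ∈ symbols
∈-symbols position = here refl
∈-symbols value = there (here refl)
∈-symbols equality = there (there (here refl))

atom : ∀ {n} → Symbol → Fin n → Fin n → Formula n
atom position = _<P_
atom value = _<V_
atom equality = _≐_

depth-atom : ∀ {n} s (i j : Fin n) → depth (atom s i j) ≡ 0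
depth-atom position i j = refl
depth-atom value i j = refl
depth-atom equality i j = refl

-- ≐ is interpreted by an arbitrary relation, not necessarily the identity.
record Structure : Set₁ where
  field
    Carrier : Set
    rel : Symbol → Carrier → Carrier → Set
open Structure public

Holds : (S : Structure) → ∀ {n} → Formula n → (Fin n → Carrier S) → Set
Holds S (x <P y) ρ = rel S position (ρ x) (ρ y)
Holds S (x <V y) ρ = rel S value (ρ x) (ρ y)
Holds S (x ≐ y) ρ = rel S equality (ρ x) (ρ y)
Holds S (¬' φ) ρ = ¬ Holds S φ ρ
Holds S (φ ∧' ψ) ρ = Holds S φ ρ × Holds S ψ ρ
Holds S (φ ∨' ψ) ρ = Holds S φ ρ ⊎ Holds S ψ ρ
Holds S (∃' φ) ρ = Σ (Carrier S) λ a → Holds S φ (extend a ρ)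
Holds S (∀' φ) ρ = (a : Carrier S) → Holds S φ (extend a ρ)

Holds-atom : ∀ S s {n} (i j : Fin n) (ρ : Fin n → Carrier S) →
             Holds S (atom s i j) ρ ≡ rel S s (ρ i) (ρ j)
Holds-atom S position i j ρ = refl
Holds-atom S value i j ρ = refl
Holds-atom S equality i j ρ = refl

-- Only surjectivity is asked of the map: injectivity is the preservation of ≐.
infix 4 _≅_
record _≅_ (A B : Structure) : Set where
  field
    fun : Carrier A → Carrier B
    inv : Carrier B → Carrier A
    fun∘inv : ∀ b → fun (inv b) ≡ b
    preserves : ∀ s x y → rel A s x y ⇔ rel B s (fun x) (fun y)
open _≅_

≅-refl : ∀ {A} → A ≅ A
≅-refl = record { fun = id ; inv = id ; fun∘inv = λ _ → refl
                ; preserves = λ _ _ _ → ⇔-id _ }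

-- Ordered sum: the left block precedes the right one in position; a point of
-- the left block is below a point of the right block in value iff l holds,
-- above it iff r holds.
leftRight : Set → Symbol → Set
leftRight l position = ⊤
leftRight l value = l
leftRight l equality = ⊥

rightLeft : Set → Symbol → Set
rightLeft r position = ⊥
rightLeft r value = r
rightLeft r equality = ⊥

sumRel : (S T : Structure) (l r : Set) →
         Symbol → Carrier S ⊎ Carrier T → Carrier S ⊎ Carrier T → Set
sumRel S T l r s (inj₁ x) (inj₁ y) = rel S s x y
sumRel S T l r s (inj₁ x) (inj₂ y) = leftRight l s
sumRel S T l r s (inj₂ x) (inj₁ y) = rightLeft r s
sumRel S T l r s (inj₂ x) (inj₂ y) = rel T s x y

infixr 6 _⊞⟨_∣_⟩_
_⊞⟨_∣_⟩_ : Structure → Set → Set → Structure → Structure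
S ⊞⟨ l ∣ r ⟩ T = record { Carrier = Carrier S ⊎ Carrier T ; rel = sumRel S T l r }

-- The Ehrenfeucht–Fraïssé game

module _ (A B : Structure) where

  SameAtoms : ∀ {I : Set} → (I → Carrier A) → (I → Carrier B) → Set
  SameAtoms ρ ρ′ = ∀ s i j → rel A s (ρ i) (ρ j) ⇔ rel B s (ρ′ i) (ρ′ j)

  record Round {I : Set} (Next : (Maybe I → Carrier A) → (Maybe I → Carrier B) → Set)
               (ρ : I → Carrier A) (ρ′ : I → Carrier B) : Set where
    field
      atoms : SameAtoms ρ ρ′
      forth : ∀ a → Σ[ b ∈ Carrier B ] Next (maybe′ ρ a) (maybe′ ρ′ b)
      back : ∀ b → Σ[ a ∈ Carrier A ] Next (maybe′ ρ a) (maybe′ ρ′ b)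

  EF : ℕ → ∀ {I} → (I → Carrier A) → (I → Carrier B) → Set
  EF zero ρ ρ′ = SameAtoms ρ ρ′
  EF (suc k) ρ ρ′ = Round (EF k) ρ ρ′

open Round public

infix 4 _≃[_]_
_≃[_]_ : Structure → ℕ → Structure → Set
A ≃[ k ] B = EF A B k emptyEnv emptyEnv

module _ {A B : Structure} where

  EF-atoms : ∀ k {I} {ρ : I → Carrier A} {ρ′ : I → Carrier B} →
             EF A B k ρ ρ′ → SameAtoms A B ρ ρ′
  EF-atoms zero g = g
  EF-atoms (suc k) g = atoms g

  EF-weaken : ∀ k {I} {ρ : I → Carrier A} {ρ′ : I → Carrier B} →
              EF A B (suc k) ρ ρ′ → EF A B k ρ ρ′
  EF-weaken zero g = atoms g
  EF-weaken (suc k) g .atoms = atoms g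
  EF-weaken (suc k) g .forth a = let (b , h) = forth g a in b , EF-weaken k h
  EF-weaken (suc k) g .back b = let (a , h) = back g b in a , EF-weaken k h

  SameAtoms-reindex : ∀ {I J} {ρ : I → Carrier A} {ρ′ : I → Carrier B}
    {σ : J → Carrier A} {σ′ : J → Carrier B} (f : J → I) →
    σ ≗ ρ ∘ f → σ′ ≗ ρ′ ∘ f → SameAtoms A B ρ ρ′ → SameAtoms A B σ σ′
  SameAtoms-reindex f e e′ g s i j rewrite e i | e j | e′ i | e′ j = g s (f i) (f j)

  EF-reindex : ∀ k {I J} {ρ : I → Carrier A} {ρ′ : I → Carrier B}
    {σ : J → Carrier A} {σ′ : J → Carrier B} (f : J → I) →
    σ ≗ ρ ∘ f → σ′ ≗ ρ′ ∘ f → EF A B k ρ ρ′ → EF A B k σ σ′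
  EF-reindex zero f e e′ g = SameAtoms-reindex f e e′ g
  EF-reindex (suc k) f e e′ g .atoms = SameAtoms-reindex f e e′ (atoms g)
  EF-reindex (suc k) f e e′ g .forth a = let (b , h) = forth g a in
    b , EF-reindex k (Maybe.map f) (maybe′-≗ f a e) (maybe′-≗ f b e′) h
  EF-reindex (suc k) f e e′ g .back b = let (a , h) = back g b in
    a , EF-reindex k (Maybe.map f) (maybe′-≗ f a e) (maybe′-≗ f b e′) h

  EF-extend : ∀ k {n} {ρ : Fin n → Carrier A} {ρ′ : Fin n → Carrier B} {a b} →
              EF A B k (maybe′ ρ a) (maybe′ ρ′ b) → EF A B k (extend a ρ) (extend b ρ′)
  EF-extend k = EF-reindex k toMaybe (λ { fz → refl ; (fs i) → refl })
                                     (λ { fz → refl ; (fs i) → refl })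

  EF-unextend : ∀ k {n} {ρ : Fin n → Carrier A} {ρ′ : Fin n → Carrier B} {a b} →
                EF A B k (extend a ρ) (extend b ρ′) → EF A B k (maybe′ ρ a) (maybe′ ρ′ b)
  EF-unextend k = EF-reindex k (maybe′ fs fz) (λ { nothing → refl ; (just i) → refl })
                                              (λ { nothing → refl ; (just i) → refl })

  EF⇒⇔ : ∀ k {n} (φ : Formula n) {ρ : Fin n → Carrier A} {ρ′ : Fin n → Carrier B} →
         EF A B k ρ ρ′ → depth φ ≤ k → Holds A φ ρ ⇔ Holds B φ ρ′
  EF⇒⇔ k (x <P y) g _ = EF-atoms k g position x y
  EF⇒⇔ k (x <V y) g _ = EF-atoms k g value x y
  EF⇒⇔ k (x ≐ y) g _ = EF-atoms k g equality x y
  EF⇒⇔ k (¬' φ) g d = ¬-cong-⇔ (EF⇒⇔ k φ g d)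
  EF⇒⇔ k (φ ∧' ψ) g d =
    EF⇒⇔ k φ g (m⊔n≤o⇒m≤o _ _ d) ×-⇔ EF⇒⇔ k ψ g (m⊔n≤o⇒n≤o _ _ d)
  EF⇒⇔ k (φ ∨' ψ) g d =
    EF⇒⇔ k φ g (m⊔n≤o⇒m≤o _ _ d) ⊎-⇔ EF⇒⇔ k ψ g (m⊔n≤o⇒n≤o _ _ d)
  EF⇒⇔ (suc k) (∃' φ) g (s≤s d) = mk⇔
    (λ { (a , h) → let (b , g′) = forth g a in
                   b , to (EF⇒⇔ k φ (EF-extend k g′) d) h })
    (λ { (b , h) → let (a , g′) = back g b in
                   a , from (EF⇒⇔ k φ (EF-extend k g′) d) h })
  EF⇒⇔ (suc k) (∀' φ) g (s≤s d) = mk⇔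
    (λ h b → let (a , g′) = back g b in to (EF⇒⇔ k φ (EF-extend k g′) d) (h a))
    (λ h a → let (b , g′) = forth g a in from (EF⇒⇔ k φ (EF-extend k g′) d) (h b))

EF-sym : ∀ {A B} k {I} {ρ : I → Carrier A} {ρ′ : I → Carrier B} →
         EF A B k ρ ρ′ → EF B A k ρ′ ρ
EF-sym zero g s i j = ⇔-sym (g s i j)
EF-sym (suc k) g .atoms s i j = ⇔-sym (atoms g s i j)
EF-sym (suc k) g .forth b = let (a , h) = back g b in a , EF-sym k h
EF-sym (suc k) g .back a = let (b , h) = forth g a in b , EF-sym k h

EF-trans : ∀ {A B C} k {I} {ρ : I → Carrier A} {ρ′ : I → Carrier B} {ρ″ : I → Carrier C} →
           EF A B k ρ ρ′ → EF B C k ρ′ ρ″ → EF A C k ρ ρ″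
EF-trans zero g h s i j = h s i j ⇔-∘ g s i j
EF-trans (suc k) g h .atoms s i j = atoms h s i j ⇔-∘ atoms g s i j
EF-trans (suc k) g h .forth a =
  let (b , g′) = forth g a ; (c , h′) = forth h b in c , EF-trans k g′ h′
EF-trans (suc k) g h .back c =
  let (b , h′) = back h c ; (a , g′) = back g b in a , EF-trans k g′ h′

≅⇒EF : ∀ {A B} (h : A ≅ B) k {I} (ρ : I → Carrier A) → EF A B k ρ (fun h ∘ ρ)
≅⇒EF h zero ρ s i j = preserves h s (ρ i) (ρ j)
≅⇒EF h (suc k) ρ .atoms s i j = preserves h s (ρ i) (ρ j)
≅⇒EF h (suc k) ρ .forth a =
  fun h a , EF-reindex k id (λ _ → refl) (λ { nothing → refl ; (just i) → refl })
                       (≅⇒EF h k (maybe′ ρ a))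
≅⇒EF h (suc k) ρ .back b =
  inv h b , EF-reindex k id (λ _ → refl) (λ { nothing → sym (fun∘inv h b) ; (just i) → refl })
                         (≅⇒EF h k (maybe′ ρ (inv h b)))

≅⇒≃ : ∀ {A B} k → A ≅ B → A ≃[ k ] B
≅⇒≃ k h = EF-reindex k id (λ ()) (λ ()) (≅⇒EF h k emptyEnv)

≃-refl : ∀ {A} k → A ≃[ k ] A
≃-refl k = ≅⇒≃ k ≅-refl

≃-resp-≅ : ∀ {A A′ B B′} k → A ≅ A′ → B ≅ B′ → A ≃[ k ] B → A′ ≃[ k ] B′
≃-resp-≅ k A≅A′ B≅B′ A≃B =
  EF-trans k (EF-sym k (≅⇒≃ k A≅A′)) (EF-trans k A≃B (≅⇒≃ k B≅B′))

module _ {S S′ T T′ : Structure} {l r : Set} where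

  SameAtoms-⊞ : ∀ {I J} {ρ : I → Carrier S} {ρ′ : I → Carrier S′}
    {σ : J → Carrier T} {σ′ : J → Carrier T′} →
    SameAtoms S S′ ρ ρ′ → SameAtoms T T′ σ σ′ →
    SameAtoms (S ⊞⟨ l ∣ r ⟩ T) (S′ ⊞⟨ l ∣ r ⟩ T′) (Sum.map ρ σ) (Sum.map ρ′ σ′)
  SameAtoms-⊞ gS gT s (inj₁ i) (inj₁ j) = gS s i j
  SameAtoms-⊞ gS gT s (inj₁ i) (inj₂ j) = ⇔-id _
  SameAtoms-⊞ gS gT s (inj₂ i) (inj₁ j) = ⇔-id _
  SameAtoms-⊞ gS gT s (inj₂ i) (inj₂ j) = gT s i j

  EF-⊞ : ∀ k {I J} {ρ : I → Carrier S} {ρ′ : I → Carrier S′}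
    {σ : J → Carrier T} {σ′ : J → Carrier T′} →
    EF S S′ k ρ ρ′ → EF T T′ k σ σ′ →
    EF (S ⊞⟨ l ∣ r ⟩ T) (S′ ⊞⟨ l ∣ r ⟩ T′) k (Sum.map ρ σ) (Sum.map ρ′ σ′)
  EF-⊞ zero gS gT = SameAtoms-⊞ gS gT
  EF-⊞ (suc k) {ρ = ρ} {ρ′} {σ} {σ′} gS gT = record
    { atoms = SameAtoms-⊞ (atoms gS) (atoms gT)
    ; forth = λ { (inj₁ a) → let (a′ , g) = forth gS a in inj₁ a′ , moveˡ g
                ; (inj₂ b) → let (b′ , g) = forth gT b in inj₂ b′ , moveʳ g }
    ; back = λ { (inj₁ a′) → let (a , g) = back gS a′ in inj₁ a , moveˡ g
               ; (inj₂ b′) → let (b , g) = back gT b′ in inj₂ b , moveʳ g }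
    }
    where
    moveˡ : ∀ {a a′} → EF S S′ k (maybe′ ρ a) (maybe′ ρ′ a′) →
            EF (S ⊞⟨ l ∣ r ⟩ T) (S′ ⊞⟨ l ∣ r ⟩ T′) k
               (maybe′ (Sum.map ρ σ) (inj₁ a)) (maybe′ (Sum.map ρ′ σ′) (inj₁ a′))
    moveˡ g = EF-reindex k pushˡ
      (λ { nothing → refl ; (just (inj₁ _)) → refl ; (just (inj₂ _)) → refl })
      (λ { nothing → refl ; (just (inj₁ _)) → refl ; (just (inj₂ _)) → refl })
      (EF-⊞ k g (EF-weaken k gT))
    moveʳ : ∀ {b b′} → EF T T′ k (maybe′ σ b) (maybe′ σ′ b′) →
            EF (S ⊞⟨ l ∣ r ⟩ T) (S′ ⊞⟨ l ∣ r ⟩ T′) k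
               (maybe′ (Sum.map ρ σ) (inj₂ b)) (maybe′ (Sum.map ρ′ σ′) (inj₂ b′))
    moveʳ g = EF-reindex k pushʳ
      (λ { nothing → refl ; (just (inj₁ _)) → refl ; (just (inj₂ _)) → refl })
      (λ { nothing → refl ; (just (inj₁ _)) → refl ; (just (inj₂ _)) → refl })
      (EF-⊞ k (EF-weaken k gS) g)

  ≃-⊞ : ∀ k → S ≃[ k ] S′ → T ≃[ k ] T′ → (S ⊞⟨ l ∣ r ⟩ T) ≃[ k ] (S′ ⊞⟨ l ∣ r ⟩ T′)
  ≃-⊞ k gS gT = EF-reindex k (λ ()) (λ ()) (λ ()) (EF-⊞ k gS gT)

-- Characteristic formulas

-- Without constants a sentence needs a quantifier to mention anything, so the
-- empty conjunction costs depth 1 without free variables and 0 otherwise.  It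
-- is not x ≐ x because ≐ need not be reflexive.
⊤′ : ∀ {n} → Formula n
⊤′ {zero} = ∀' ⊤′
⊤′ {suc n} = ¬' ((fz ≐ fz) ∧' (¬' (fz ≐ fz)))

⊤′-holds : ∀ S {n} (ρ : Fin n → Carrier S) → Holds S ⊤′ ρ
⊤′-holds S {zero} ρ a = ⊤′-holds S (extend a ρ)
⊤′-holds S {suc n} ρ (e , ¬e) = ¬e e

⋀ ⋁ : ∀ {n} {X : Set} → List X → (X → Formula n) → Formula n
⋀ [] f = ⊤′
⋀ (x ∷ xs) f = f x ∧' ⋀ xs f
⋁ [] f = ¬' ⊤′
⋁ (x ∷ xs) f = f x ∨' ⋁ xs f

module _ (S : Structure) {n} {X : Set} (f : X → Formula n) (ρ : Fin n → Carrier S) where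

  ⋀-intro : ∀ xs → (∀ x → Holds S (f x) ρ) → Holds S (⋀ xs f) ρ
  ⋀-intro [] h = ⊤′-holds S ρ
  ⋀-intro (x ∷ xs) h = h x , ⋀-intro xs h

  ⋀-elim : ∀ {xs x} → Holds S (⋀ xs f) ρ → x ∈ xs → Holds S (f x) ρ
  ⋀-elim (h , _) (here refl) = h
  ⋀-elim (_ , h) (there x∈xs) = ⋀-elim h x∈xs

  ⋁-intro : ∀ {xs x} → x ∈ xs → Holds S (f x) ρ → Holds S (⋁ xs f) ρ
  ⋁-intro (here refl) h = inj₁ h
  ⋁-intro (there x∈xs) h = inj₂ (⋁-intro x∈xs h)

  ⋁-elim : ∀ xs → Holds S (⋁ xs f) ρ → Σ[ x ∈ X ] Holds S (f x) ρ
  ⋁-elim [] h = ⊥-elim (h (⊤′-holds S ρ))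
  ⋁-elim (x ∷ xs) (inj₁ h) = x , h
  ⋁-elim (x ∷ xs) (inj₂ h) = ⋁-elim xs h

module _ {n} {X : Set} (f : X → Formula n) {d} (f≤d : ∀ x → depth (f x) ≤ d)
         (⊤′≤d : depth (⊤′ {n}) ≤ d) where

  depth-⋀ : ∀ xs → depth (⋀ xs f) ≤ d
  depth-⋀ [] = ⊤′≤d
  depth-⋀ (x ∷ xs) = ⊔-lub (f≤d x) (depth-⋀ xs)

  depth-⋁ : ∀ xs → depth (⋁ xs f) ≤ d
  depth-⋁ [] = ⊤′≤d
  depth-⋁ (x ∷ xs) = ⊔-lub (f≤d x) (depth-⋁ xs)

literal : ∀ {n} {Q : Set} → Dec Q → Formula n → Formula n
literal (yes _) φ = φ
literal (no _) φ = ¬' φ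

literal-holds : ∀ {S n Q} {φ : Formula n} {ρ} (d : Dec Q) →
                Holds S φ ρ ≡ Q → Holds S (literal d φ) ρ
literal-holds (yes q) refl = q
literal-holds (no ¬q) refl = ¬q

literal-decides : ∀ {S n Q} {φ : Formula n} {ρ} (d : Dec Q) →
                  Holds S (literal d φ) ρ → Q ⇔ Holds S φ ρ
literal-decides (yes q) h = mk⇔ (λ _ → h) (λ _ → q)
literal-decides (no ¬q) h = mk⇔ (λ q → ⊥-elim (¬q q)) (λ h′ → ⊥-elim (h h′))

depth-literal : ∀ {n Q} (d : Dec Q) (φ : Formula n) → depth (literal d φ) ≡ depth φ
depth-literal (yes _) φ = refl
depth-literal (no _) φ = refl

module Characteristic (A : Structure) (elements : List (Carrier A))
  (∈-elements : ∀ a → a ∈ elements) (rel? : ∀ s x y → Dec (rel A s x y)) where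

  atomLiteral : ∀ {n} → (Fin n → Carrier A) → Fin n → Fin n → Symbol → Formula n
  atomLiteral ρ i j s = literal (rel? s (ρ i) (ρ j)) (atom s i j)

  pairDiagram : ∀ {n} → (Fin n → Carrier A) → Fin n → Fin n → Formula n
  pairDiagram ρ i j = ⋀ symbols (atomLiteral ρ i j)

  diagramRow : ∀ {n} → (Fin n → Carrier A) → Fin n → Formula n
  diagramRow {n} ρ i = ⋀ (allFin n) (pairDiagram ρ i)

  diagram : ∀ {n} → (Fin n → Carrier A) → Formula n
  diagram {n} ρ = ⋀ (allFin n) (diagramRow ρ)

  χ : ℕ → ∀ {n} → (Fin n → Carrier A) → Formula n
  χ zero ρ = diagram ρ
  χ (suc k) ρ = diagram ρ ∧' (⋀ elements (λ a → ∃' (χ k (extend a ρ)))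
                          ∧' ∀' (⋁ elements (λ a → χ k (extend a ρ))))

  diagram-holds : ∀ {n} (ρ : Fin n → Carrier A) → Holds A (diagram ρ) ρ
  diagram-holds {n} ρ =
    ⋀-intro A (diagramRow ρ) ρ (allFin n) λ i →
    ⋀-intro A (pairDiagram ρ i) ρ (allFin n) λ j →
    ⋀-intro A (atomLiteral ρ i j) ρ symbols λ s →
    literal-holds (rel? s (ρ i) (ρ j)) (Holds-atom A s i j ρ)

  χ-holds : ∀ k {n} (ρ : Fin n → Carrier A) → Holds A (χ k ρ) ρ
  χ-holds zero ρ = diagram-holds ρ
  χ-holds (suc k) ρ = diagram-holds ρ
    , ⋀-intro A (λ a → ∃' (χ k (extend a ρ))) ρ elements (λ a → a , χ-holds k (extend a ρ))
    , λ a → ⋁-intro A (λ a → χ k (extend a ρ)) (extend a ρ) (∈-elements a)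
                     (χ-holds k (extend a ρ))

  depth-diagram : ∀ {n} (ρ : Fin n → Carrier A) {d} → depth (⊤′ {n}) ≤ d →
                  depth (diagram ρ) ≤ d
  depth-diagram {n} ρ {d} ⊤′≤d =
    depth-⋀ (diagramRow ρ) (λ i →
      depth-⋀ (pairDiagram ρ i) (λ j →
        depth-⋀ (atomLiteral ρ i j) (λ s → atomLiteral≤ i j s) ⊤′≤d symbols)
      ⊤′≤d (allFin n))
    ⊤′≤d (allFin n)
    where
    atomLiteral≤ : ∀ i j s → depth (atomLiteral ρ i j s) ≤ d
    atomLiteral≤ i j s
      rewrite depth-literal (rel? s (ρ i) (ρ j)) (atom s i j) | depth-atom s i j = z≤n

  depth-χ : ∀ k {n} (ρ : Fin n → Carrier A) → depth (⊤′ {n}) ≤ k → depth (χ k ρ) ≤ k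
  depth-χ zero ρ ⊤′≤k = depth-diagram ρ ⊤′≤k
  depth-χ (suc k) ρ ⊤′≤k = ⊔-lub (depth-diagram ρ ⊤′≤k) (⊔-lub
    (depth-⋀ (λ a → ∃' (χ k (extend a ρ))) (λ a → s≤s (depth-χ k (extend a ρ) z≤n)) ⊤′≤k elements)
    (s≤s (depth-⋁ (λ a → χ k (extend a ρ)) (λ a → depth-χ k (extend a ρ) z≤n) z≤n elements)))

  module _ (B : Structure) where

    diagram⇒SameAtoms : ∀ {n} (ρ : Fin n → Carrier A) (ρ′ : Fin n → Carrier B) →
                        Holds B (diagram ρ) ρ′ → SameAtoms A B ρ ρ′
    diagram⇒SameAtoms ρ ρ′ h s i j =
      subst (rel A s (ρ i) (ρ j) ⇔_) (Holds-atom B s i j ρ′)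
        (literal-decides (rel? s (ρ i) (ρ j)) (⋀-elim B (atomLiteral ρ i j) ρ′ hᵢⱼ (∈-symbols s)))
      where
      hᵢ = ⋀-elim B (diagramRow ρ) ρ′ h (∈-allFin i)
      hᵢⱼ = ⋀-elim B (pairDiagram ρ i) ρ′ hᵢ (∈-allFin j)

    χ⇒EF : ∀ k {n} (ρ : Fin n → Carrier A) (ρ′ : Fin n → Carrier B) →
           Holds B (χ k ρ) ρ′ → EF A B k ρ ρ′
    χ⇒EF zero ρ ρ′ h = diagram⇒SameAtoms ρ ρ′ h
    χ⇒EF (suc k) ρ ρ′ (h₀ , h∃ , h∀) = record
      { atoms = diagram⇒SameAtoms ρ ρ′ h₀
      ; forth = λ a → let (b , h) = ⋀-elim B (λ a → ∃' (χ k (extend a ρ))) ρ′ h∃ (∈-elements a) in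
          b , EF-unextend k (χ⇒EF k (extend a ρ) (extend b ρ′) h)
      ; back = λ b → let (a , h) = ⋁-elim B (λ a → χ k (extend a ρ)) (extend b ρ′) elements (h∀ b) in
          a , EF-unextend k (χ⇒EF k (extend a ρ) (extend b ρ′) h)
      }

-- Permutations as structures

listRel : (σ : List ℕ) → Symbol → Pt σ → Pt σ → Set
listRel σ position i j = toℕ i < toℕ j
listRel σ value i j = lookup σ i < lookup σ j
listRel σ equality i j = i ≡ j

listRel? : ∀ σ s (i j : Pt σ) → Dec (listRel σ s i j)
listRel? σ position i j = toℕ i <? toℕ j
listRel? σ value i j = lookup σ i <? lookup σ j
listRel? σ equality i j = i ≟ j

⟦_⟧ : List ℕ → Structure
⟦ σ ⟧ = record { Carrier = Pt σ ; rel = listRel σ }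

Sat⇔Holds : ∀ σ {n} (φ : Formula n) (ρ : Fin n → Pt σ) → Sat σ φ ρ ⇔ Holds ⟦ σ ⟧ φ ρ
Sat⇔Holds σ (x <P y) ρ = ⇔-id _
Sat⇔Holds σ (x <V y) ρ = ⇔-id _
Sat⇔Holds σ (x ≐ y) ρ = ⇔-id _
Sat⇔Holds σ (¬' φ) ρ = ¬-cong-⇔ (Sat⇔Holds σ φ ρ)
Sat⇔Holds σ (φ ∧' ψ) ρ = Sat⇔Holds σ φ ρ ×-⇔ Sat⇔Holds σ ψ ρ
Sat⇔Holds σ (φ ∨' ψ) ρ = Sat⇔Holds σ φ ρ ⊎-⇔ Sat⇔Holds σ ψ ρ
Sat⇔Holds σ (∃' φ) ρ = ∃-cong-⇔ λ a → Sat⇔Holds σ φ (extend a ρ)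
Sat⇔Holds σ (∀' φ) ρ = ∀-cong-⇔ λ a → Sat⇔Holds σ φ (extend a ρ)

≃⇒≡ : ∀ {σ τ} k → ⟦ σ ⟧ ≃[ k ] ⟦ τ ⟧ → σ ≡[ k ] τ
≃⇒≡ {σ} {τ} k g φ d =
  ⇔-sym (Sat⇔Holds τ φ emptyEnv) ⇔-∘ (EF⇒⇔ k φ g d ⇔-∘ Sat⇔Holds σ φ emptyEnv)

≡⇒≃ : ∀ {σ τ} k → σ ≡[ suc k ] τ → ⟦ σ ⟧ ≃[ suc k ] ⟦ τ ⟧
≡⇒≃ {σ} {τ} k σ≡τ = χ⇒EF ⟦ τ ⟧ (suc k) emptyEnv emptyEnv holds
  where
  open Characteristic ⟦ σ ⟧ (allFin (length σ)) ∈-allFin (listRel? σ)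
  φ = χ (suc k) emptyEnv
  holds : Holds ⟦ τ ⟧ φ emptyEnv
  holds = to (Sat⇔Holds τ φ emptyEnv) (to (σ≡τ φ (depth-χ (suc k) emptyEnv (s≤s z≤n)))
            (from (Sat⇔Holds σ φ emptyEnv) (χ-holds (suc k) emptyEnv)))

lookup-++-↑ˡ : ∀ (σ ρ : List ℕ) i →
               lookup (σ ++ ρ) (cast (sym (length-++ σ)) (i ↑ˡ length ρ)) ≡ lookup σ i
lookup-++-↑ˡ (x ∷ σ) ρ fz = refl
lookup-++-↑ˡ (x ∷ σ) ρ (fs i) = lookup-++-↑ˡ σ ρ i

lookup-++-↑ʳ : ∀ (σ ρ : List ℕ) j →
               lookup (σ ++ ρ) (cast (sym (length-++ σ)) (length σ ↑ʳ j)) ≡ lookup ρ j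
lookup-++-↑ʳ [] ρ j = cong (lookup ρ) (cast-is-id refl j)
lookup-++-↑ʳ (x ∷ σ) ρ j = lookup-++-↑ʳ σ ρ j

module _ (σ ρ : List ℕ) where

  index++ : Pt σ ⊎ Pt ρ → Pt (σ ++ ρ)
  index++ x = cast (sym (length-++ σ)) (join (length σ) (length ρ) x)

  unindex++ : Pt (σ ++ ρ) → Pt σ ⊎ Pt ρ
  unindex++ i = splitAt (length σ) (cast (length-++ σ) i)

  index++-unindex++ : ∀ i → index++ (unindex++ i) ≡ i
  index++-unindex++ i =
    trans (cong (cast (sym (length-++ σ))) (join-splitAt (length σ) (length ρ) _))
          (cast-involutive (sym (length-++ σ)) (length-++ σ) i)

  unindex++-index++ : ∀ x → unindex++ (index++ x) ≡ x
  unindex++-index++ x =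
    trans (cong (splitAt (length σ)) (cast-involutive (length-++ σ) (sym (length-++ σ)) _))
          (splitAt-join (length σ) (length ρ) x)

  index++-injective : ∀ {x y} → index++ x ≡ index++ y → x ≡ y
  index++-injective {x} {y} e =
    trans (sym (unindex++-index++ x)) (trans (cong unindex++ e) (unindex++-index++ y))

  toℕ-index++ : ∀ x → toℕ (index++ x) ≡ [ toℕ , (length σ +_) ∘ toℕ ]′ x
  toℕ-index++ (inj₁ i) = trans (toℕ-cast (sym (length-++ σ)) _) (toℕ-↑ˡ i (length ρ))
  toℕ-index++ (inj₂ j) = trans (toℕ-cast (sym (length-++ σ)) _) (toℕ-↑ʳ (length σ) j)

  lookup-index++ : ∀ x → lookup (σ ++ ρ) (index++ x) ≡ [ lookup σ , lookup ρ ]′ x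
  lookup-index++ (inj₁ i) = lookup-++-↑ˡ σ ρ i
  lookup-index++ (inj₂ j) = lookup-++-↑ʳ σ ρ j

  ++-≅ : ∀ {l r} → (∀ i j → (l ⇔ lookup σ i < lookup ρ j) × (r ⇔ lookup ρ j < lookup σ i)) →
         ⟦ σ ⟧ ⊞⟨ l ∣ r ⟩ ⟦ ρ ⟧ ≅ ⟦ σ ++ ρ ⟧
  ++-≅ {l} {r} cross = record
    { fun = index++ ; inv = unindex++ ; fun∘inv = index++-unindex++
    ; preserves = λ
      { position x y → <-cong-⇔ (sym (toℕ-index++ x)) (sym (toℕ-index++ y)) ⇔-∘ position⇔ x y
      ; value x y → <-cong-⇔ (sym (lookup-index++ x)) (sym (lookup-index++ y)) ⇔-∘ value⇔ x y
      ; equality x y → equality⇔ x y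
      }
    }
    where
    S = ⟦ σ ⟧ ⊞⟨ l ∣ r ⟩ ⟦ ρ ⟧
    left<right : ∀ i j → toℕ i < length σ + toℕ j
    left<right i j = <-≤-trans (toℕ<n i) (m≤m+n (length σ) (toℕ j))

    position⇔ : ∀ x y → rel S position x y ⇔
      ([ toℕ , (length σ +_) ∘ toℕ ]′ x < [ toℕ , (length σ +_) ∘ toℕ ]′ y)
    position⇔ (inj₁ i) (inj₁ j) = ⇔-id _
    position⇔ (inj₁ i) (inj₂ j) = mk⇔ (λ _ → left<right i j) (λ _ → tt)
    position⇔ (inj₂ j) (inj₁ i) = mk⇔ ⊥-elim (λ h → <-asym h (left<right i j))
    position⇔ (inj₂ i) (inj₂ j) = mk⇔ (+-monoʳ-< (length σ)) (+-cancelˡ-< (length σ) _ _)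

    value⇔ : ∀ x y → rel S value x y ⇔ ([ lookup σ , lookup ρ ]′ x < [ lookup σ , lookup ρ ]′ y)
    value⇔ (inj₁ i) (inj₁ j) = ⇔-id _
    value⇔ (inj₁ i) (inj₂ j) = proj₁ (cross i j)
    value⇔ (inj₂ j) (inj₁ i) = proj₂ (cross i j)
    value⇔ (inj₂ i) (inj₂ j) = ⇔-id _

    equality⇔ : ∀ x y → rel S equality x y ⇔ (index++ x ≡ index++ y)
    equality⇔ (inj₁ i) (inj₁ j) =
      mk⇔ (cong (index++ ∘ inj₁)) (inj₁-injective ∘ index++-injective)
    equality⇔ (inj₁ i) (inj₂ j) =
      mk⇔ ⊥-elim (λ e → case index++-injective {inj₁ i} {inj₂ j} e of λ ())
    equality⇔ (inj₂ j) (inj₁ i) =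
      mk⇔ ⊥-elim (λ e → case index++-injective {inj₂ j} {inj₁ i} e of λ ())
    equality⇔ (inj₂ i) (inj₂ j) =
      mk⇔ (cong (index++ ∘ inj₂)) (inj₂-injective ∘ index++-injective)

lookup-map-cast : ∀ (f : ℕ → ℕ) σ i →
                  lookup (map f σ) (cast (sym (length-map f σ)) i) ≡ f (lookup σ i)
lookup-map-cast f (x ∷ σ) fz = refl
lookup-map-cast f (x ∷ σ) (fs i) = lookup-map-cast f σ i

map-≅ : ∀ (f : ℕ → ℕ) σ → (∀ {a b} → (a < b) ⇔ (f a < f b)) → ⟦ σ ⟧ ≅ ⟦ map f σ ⟧
map-≅ f σ f-mono = record
  { fun = index ; inv = cast (length-map f σ)
  ; fun∘inv = cast-involutive (sym (length-map f σ)) (length-map f σ)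
  ; preserves = λ
    { position i j → <-cong-⇔ (sym (toℕ-index i)) (sym (toℕ-index j))
    ; value i j →
        <-cong-⇔ (sym (lookup-map-cast f σ i)) (sym (lookup-map-cast f σ j)) ⇔-∘ f-mono
    ; equality i j → mk⇔ (cong index)
        (λ e → toℕ-injective (trans (sym (toℕ-index i)) (trans (cong toℕ e) (toℕ-index j))))
    }
  }
  where
  index = cast (sym (length-map f σ))
  toℕ-index : ∀ i → toℕ (index i) ≡ toℕ i
  toℕ-index = toℕ-cast (sym (length-map f σ))

shift-≅ : ∀ c σ → ⟦ σ ⟧ ≅ ⟦ map (λ v → v + c) σ ⟧
shift-≅ c σ = map-≅ (λ v → v + c) σ (mk⇔ (+-monoˡ-< c) (+-cancelʳ-< c _ _))

≃-shift : ∀ {σ₁ σ₂} k c₁ c₂ → ⟦ σ₁ ⟧ ≃[ k ] ⟦ σ₂ ⟧ →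
          ⟦ map (λ v → v + c₁) σ₁ ⟧ ≃[ k ] ⟦ map (λ v → v + c₂) σ₂ ⟧
≃-shift {σ₁} {σ₂} k c₁ c₂ = ≃-resp-≅ k (shift-≅ c₁ σ₁) (shift-≅ c₂ σ₂)

lookup<length : ∀ {σ} → IsPerm σ → ∀ i → lookup σ i < length σ
lookup<length p i = ∈-upTo⁻ (∈-resp-↭ p (∈-lookup i))

≤-lookup-shift : ∀ c σ j → c ≤ lookup (map (λ v → v + c) σ) j
≤-lookup-shift c σ j =
  let (x , _ , e) = ∈-map⁻ (λ v → v + c) {xs = σ} (∈-lookup j) in subst (c ≤_) (sym e) (m≤n+m c x)

below⇔ : ∀ {a b} → a < b → (⊤ ⇔ a < b) × (⊥ ⇔ b < a)
below⇔ a<b = mk⇔ (λ _ → a<b) (λ _ → tt) , mk⇔ ⊥-elim (λ b<a → <-asym a<b b<a)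

⊕-≅ : ∀ {τ} σ → IsPerm τ → ⟦ τ ⟧ ⊞⟨ ⊤ ∣ ⊥ ⟩ ⟦ map (λ v → v + length τ) σ ⟧ ≅ ⟦ τ ⊕ σ ⟧
⊕-≅ {τ} σ p = ++-≅ τ _ λ i j →
  below⇔ (<-≤-trans (lookup<length p i) (≤-lookup-shift (length τ) σ j))

⊖-≅ : ∀ σ {π} → IsPerm π → ⟦ map (λ v → v + length π) σ ⟧ ⊞⟨ ⊥ ∣ ⊤ ⟩ ⟦ π ⟧ ≅ ⟦ σ ⊖ π ⟧
⊖-≅ σ {π} p = ++-≅ _ π λ i j →
  swap (below⇔ (<-≤-trans (lookup<length p j) (≤-lookup-shift (length π) σ i)))

⊕-cong : ∀ {τ₁ τ₂ σ₁ σ₂} k → IsPerm τ₁ → IsPerm τ₂ →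
         ⟦ τ₁ ⟧ ≃[ k ] ⟦ τ₂ ⟧ → ⟦ σ₁ ⟧ ≃[ k ] ⟦ σ₂ ⟧ → ⟦ τ₁ ⊕ σ₁ ⟧ ≃[ k ] ⟦ τ₂ ⊕ σ₂ ⟧
⊕-cong {τ₁} {τ₂} {σ₁} {σ₂} k p₁ p₂ τ₁≃τ₂ σ₁≃σ₂ =
  ≃-resp-≅ k (⊕-≅ σ₁ p₁) (⊕-≅ σ₂ p₂) (≃-⊞ k τ₁≃τ₂ (≃-shift k (length τ₁) (length τ₂) σ₁≃σ₂))

⊖-cong : ∀ {σ₁ σ₂ π₁ π₂} k → IsPerm π₁ → IsPerm π₂ →
         ⟦ σ₁ ⟧ ≃[ k ] ⟦ σ₂ ⟧ → ⟦ π₁ ⟧ ≃[ k ] ⟦ π₂ ⟧ → ⟦ σ₁ ⊖ π₁ ⟧ ≃[ k ] ⟦ σ₂ ⊖ π₂ ⟧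
⊖-cong {σ₁} {σ₂} {π₁} {π₂} k p₁ p₂ σ₁≃σ₂ π₁≃π₂ =
  ≃-resp-≅ k (⊖-≅ σ₁ p₁) (⊖-≅ σ₂ p₂) (≃-⊞ k (≃-shift k (length π₁) (length π₂) σ₁≃σ₂) π₁≃π₂)

lemma3p1 : (k : ℕ) → 2 ≤ k → (τ₁ τ₂ π₁ π₂ : List ℕ) →
    IsPerm τ₁ → IsPerm τ₂ → IsPerm π₁ → IsPerm π₂ →
    τ₁ ≡[ k ] τ₂ → π₁ ≡[ k ] π₂ →
    (τ₁ ⊕ (one ⊖ π₁)) ≡[ k ] (τ₂ ⊕ (one ⊖ π₂))
lemma3p1 (suc k) _ τ₁ τ₂ π₁ π₂ pτ₁ pτ₂ pπ₁ pπ₂ τ₁≡τ₂ π₁≡π₂ =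
  ≃⇒≡ (suc k) (⊕-cong (suc k) pτ₁ pτ₂ (≡⇒≃ k τ₁≡τ₂)
                (⊖-cong (suc k) pπ₁ pπ₂ (≃-refl (suc k)) (≡⇒≃ k π₁≡π₂)))
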